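{- Let $\mathcal{B}_n$ be the set of $n\times n$ Boolean matrices, let $X\in\mathcal{B}_n$ and let $\mathcal{H}:\mathcal{B}_n\rightarrow\mathcal{B}_n$ be the mapping defined by means of the following equations: $P=D^*$; $E_1=(A+BP^2C)^*$, $E_2=E_1BH_2^2CE_1$, $E=E_1+E_2$; $F_1=E_1^2BP$, $F_2=E_1BH_2^2$, $F=F_1+F_2$; $G_1=PCE_1^2$, $G_2=H_2^2CE_1$, $G=G_1+G_2$; $H_1=PCE_1^2BP$, $H_2=(D+CE_1^2B)^*$, $H=H_1+H_2$; where $X$ and $Y=\mathcal{H}(X)$ are partitioned into $\frac{n}{2}\times\frac{n}{2}$ blocks as $X=\begin{pmatrix}A&B\\ C&D\end{pmatrix}$ and $Y=\begin{pmatrix}E&F\\ G&H\end{pmatrix}$. Then, for any $X\in\mathcal{B}_n$, $\mathcal{H}(X)=X^*$.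
   Context: Matrices are Boolean, with sum and product over the Boolean semiring; $X^*$ denotes the Kleene closure (reflexive transitive closure) of the Boolean matrix $X$; $n$ is assumed to be a power of $2$. -}

module Defs where

open import Data.Nat using (ℕ; zero; suc; _+_)
open import Data.Fin using (Fin; zero; suc; splitAt; _↑ˡ_; _↑ʳ_)
open import Data.Fin.Properties using (_≟_)
open import Data.Bool using (Bool; true; false; _∧_; _∨_)
open import Data.Sum using (_⊎_; inj₁; inj₂)
open import Relation.Nullary.Decidable using (⌊_⌋)

Mat : ℕ → Set
Mat n = Fin n → Fin n → Bool

bigOr : ∀ {n} → (Fin n → Bool) → Bool
bigOr {zero}  f = false
bigOr {suc n} f = f zero ∨ bigOr (λ i → f (suc i))

_⊕_ : ∀ {n} → Mat n → Mat n → Mat n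
(X ⊕ Y) i j = X i j ∨ Y i j

_⊗_ : ∀ {n} → Mat n → Mat n → Mat n
(X ⊗ Y) i j = bigOr (λ k → X i k ∧ Y k j)

infixl 6 _⊕_
infixl 7 _⊗_

zeroM : ∀ {n} → Mat n
zeroM i j = false

idM : ∀ {n} → Mat n
idM i j = ⌊ i ≟ j ⌋

pow : ∀ {n} → Mat n → ℕ → Mat n
pow X zero    = idM
pow X (suc k) = X ⊗ pow X k

powSum : ∀ {n} → Mat n → ℕ → Mat n
powSum X zero    = idM
powSum X (suc k) = powSum X k ⊕ pow X (suc k)

-- Kleene closure X* = Σ_{k ≥ 0} X^k.  Over the Boolean semiring this sum
-- stabilises at k = n (a walk of length > n can be shortened), so the
-- infinite sum is computed as the finite sum of the powers X^0 .. X^n.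
_* : ∀ {n} → Mat n → Mat n
_* {n} X = powSum X n

blkA blkB blkC blkD : ∀ {m} → Mat (m + m) → Mat m
blkA {m} X i j = X (i ↑ˡ m) (j ↑ˡ m)
blkB {m} X i j = X (i ↑ˡ m) (m ↑ʳ j)
blkC {m} X i j = X (m ↑ʳ i) (j ↑ˡ m)
blkD {m} X i j = X (m ↑ʳ i) (m ↑ʳ j)

blocks : ∀ {m} → Mat m → Mat m → Mat m → Mat m → Mat (m + m)
blocks {m} E F G H i j with splitAt m i | splitAt m j
... | inj₁ i' | inj₁ j' = E i' j'
... | inj₁ i' | inj₂ j' = F i' j'
... | inj₂ i' | inj₁ j' = G i' j'
... | inj₂ i' | inj₂ j' = H i' j'

ℋ : ∀ {m} → Mat (m + m) → Mat (m + m)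
ℋ {m} X = blocks {m} E F G H
  where
  A = blkA {m} X
  B = blkB {m} X
  C = blkC {m} X
  D = blkD {m} X
  P  = D *
  E₁ = (A ⊕ B ⊗ (P ⊗ P) ⊗ C) *
  H₂ = (D ⊕ C ⊗ (E₁ ⊗ E₁) ⊗ B) *
  E₂ = E₁ ⊗ B ⊗ (H₂ ⊗ H₂) ⊗ C ⊗ E₁
  E  = E₁ ⊕ E₂
  F₁ = (E₁ ⊗ E₁) ⊗ B ⊗ P
  F₂ = E₁ ⊗ B ⊗ (H₂ ⊗ H₂)
  F  = F₁ ⊕ F₂
  G₁ = P ⊗ C ⊗ (E₁ ⊗ E₁)
  G₂ = (H₂ ⊗ H₂) ⊗ C ⊗ E₁
  G  = G₁ ⊕ G₂
  H₁ = P ⊗ C ⊗ (E₁ ⊗ E₁) ⊗ B ⊗ P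
  H  = H₁ ⊕ H₂

-- Entries of X* are exactly the walks in the graph of X: a walk can be shortened to at most n
-- steps by loop erasure.  Every block of ℋ(X) is built from blocks of X by sums, products and
-- closures, so each of its entries is realised by a walk in X.  Conversely, the block form of
-- the closure (E₁, E₁BP ; PCE₁, P + PCE₁BP), with P = D* and E₁ = (A + BPC)*, is reflexive and
-- closed under prepending an edge of X, hence contains every walk; and each of its blocks lies
-- in the corresponding block of ℋ(X), since E₁ ⊆ E₁E₁, P ⊆ H₂ and BPC ⊆ BPPC.
module Submission where

open import Defs
open import Data.Nat using (ℕ; zero; suc; _+_; _^_; _≤_; _<_; z≤n; s≤s)
open import Data.Nat.Properties using (m≤n⇒m<n∨m≡n; <⇒≤)
open import Data.Fin using (Fin; zero; suc; splitAt; join)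
open import Data.Fin.Properties using (_≟_; injective⇒≤; join-splitAt)
open import Data.Bool using (Bool; true; false; T)
open import Data.Bool.Properties using (T-∧; T-∨)
open import Data.Product using (Σ; ∃; _,_)
open import Data.Sum using (_⊎_; inj₁; inj₂)
open import Data.List as List using (List; []; _∷_; lookup)
open import Data.List.Relation.Unary.All as All using ()
open import Data.List.Relation.Unary.All.Properties.Core using (¬Any⇒All¬)
open import Data.List.Relation.Unary.AllPairs as AllPairs using ()
open import Data.List.Relation.Unary.Any using (here; there)
open import Data.List.Relation.Unary.Unique.Propositional using (Unique)
open import Data.List.Membership.Propositional using (_∈_)
open import Data.List.Membership.Propositional.Properties using (∈-lookup)
import Data.List.Membership.DecPropositional as DecMembership
open import Data.Empty using (⊥-elim)
open import Function using (_∘_; Equivalence)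
open import Level using (Level; 0ℓ)
open import Relation.Binary.Core using (Rel; _⇒_)
open import Relation.Binary.Definitions using (Reflexive; Transitive)
open import Relation.Binary.Construct.Closure.ReflexiveTransitive
  using (Star; ε; _◅_; _◅◅_; fold; map; kleisliStar)
open import Relation.Binary.Construct.Composition using (_;_)
open import Relation.Binary.Construct.Union using (_∪_)
open import Relation.Binary.PropositionalEquality using (_≡_; refl; sym; cong; subst; subst₂)
open import Relation.Nullary using (yes; no)
open import Relation.Nullary.Decidable using (fromWitness; toWitness)

T-injective : ∀ {x y} → (T x → T y) → (T y → T x) → x ≡ y
T-injective {false} {false} _ _ = refl
T-injective {false} {true}  _ g = ⊥-elim (g _)
T-injective {true}  {false} f _ = ⊥-elim (f _)
T-injective {true}  {true}  _ _ = refl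

bigOr-intro : ∀ {n} (f : Fin n → Bool) k → T (f k) → T (bigOr f)
bigOr-intro f zero    t = Equivalence.from T-∨ (inj₁ t)
bigOr-intro f (suc k) t = Equivalence.from (T-∨ {f zero}) (inj₂ (bigOr-intro (f ∘ suc) k t))

bigOr-elim : ∀ {n} (f : Fin n → Bool) → T (bigOr f) → ∃ (T ∘ f)
bigOr-elim {suc n} f t with Equivalence.to (T-∨ {f zero}) t
... | inj₁ t₀ = zero , t₀
... | inj₂ t₊ with bigOr-elim (f ∘ suc) t₊
...   | k , tₖ = suc k , tₖ

-- A record rather than T (M i j), so that M can be recovered from the type by unification.
record Entry {n} (M : Mat n) (i j : Fin n) : Set where
  constructor ⟨_⟩
  field entry : T (M i j)
open Entry

entrywise-≡ : ∀ {n} {M N : Mat n} → Entry M ⇒ Entry N → Entry N ⇒ Entry M → ∀ i j → M i j ≡ N i j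
entrywise-≡ M⇒N N⇒M i j = T-injective (λ t → entry (M⇒N {i} {j} ⟨ t ⟩)) (λ t → entry (N⇒M {i} {j} ⟨ t ⟩))

module _ {n} {M N : Mat n} where

  ⊗-intro : ∀ {i k j} → Entry M i k → Entry N k j → Entry (M ⊗ N) i j
  ⊗-intro {k = k} ⟨ s ⟩ ⟨ t ⟩ = ⟨ bigOr-intro _ k (Equivalence.from T-∧ (s , t)) ⟩

  ⊗-elim : Entry (M ⊗ N) ⇒ (Entry M ; Entry N)
  ⊗-elim ⟨ t ⟩ with bigOr-elim _ t
  ... | k , tₖ with Equivalence.to T-∧ tₖ
  ...   | s , s′ = k , ⟨ s ⟩ , ⟨ s′ ⟩

  ⊕-intro : (Entry M ∪ Entry N) ⇒ Entry (M ⊕ N)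
  ⊕-intro (inj₁ ⟨ s ⟩) = ⟨ Equivalence.from T-∨ (inj₁ s) ⟩
  ⊕-intro {i} {j} (inj₂ ⟨ t ⟩) = ⟨ Equivalence.from (T-∨ {M i j}) (inj₂ t) ⟩

  ⊕-elim : Entry (M ⊕ N) ⇒ (Entry M ∪ Entry N)
  ⊕-elim {i} {j} ⟨ t ⟩ with Equivalence.to (T-∨ {M i j}) t
  ... | inj₁ s = inj₁ ⟨ s ⟩
  ... | inj₂ s = inj₂ ⟨ s ⟩

Walk : ∀ {n} → Mat n → Rel (Fin n) 0ℓ
Walk M = Star (Entry M)

module _ {n} {M : Mat n} where

  length : ∀ {i j} → Walk M i j → ℕ
  length ε       = 0
  length (_ ◅ w) = suc (length w)

  vertices : ∀ {i j} → Walk M i j → List (Fin n)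
  vertices (ε {i})       = i ∷ []
  vertices (_◅_ {i} _ w) = i ∷ vertices w

  length-vertices : ∀ {i j} (w : Walk M i j) → List.length (vertices w) ≡ suc (length w)
  length-vertices ε       = refl
  length-vertices (_ ◅ w) = cong suc (length-vertices w)

  pow-intro : ∀ {i j} (w : Walk M i j) → Entry (pow M (length w)) i j
  pow-intro ε       = ⟨ fromWitness refl ⟩
  pow-intro (e ◅ w) = ⊗-intro e (pow-intro w)

  pow-elim : ∀ L → Entry (pow M L) ⇒ Walk M
  pow-elim zero ⟨ t ⟩ with toWitness t
  ... | refl = ε
  pow-elim (suc L) t with ⊗-elim t
  ... | _ , e , t′ = e ◅ pow-elim L t′

  powSum-intro : ∀ {L K} → L ≤ K → Entry (pow M L) ⇒ Entry (powSum M K)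
  powSum-intro {K = zero} z≤n t = t
  powSum-intro {K = suc K} L≤1+K t with m≤n⇒m<n∨m≡n L≤1+K
  ... | inj₁ (s≤s L≤K) = ⊕-intro (inj₁ (powSum-intro L≤K t))
  ... | inj₂ refl      = ⊕-intro (inj₂ t)

  powSum-elim : ∀ K → Entry (powSum M K) ⇒ Walk M
  powSum-elim zero    t = pow-elim zero t
  powSum-elim (suc K) t with ⊕-elim t
  ... | inj₁ t′ = powSum-elim K t′
  ... | inj₂ t′ = pow-elim (suc K) t′

  SimpleWalk : Rel (Fin n) 0ℓ
  SimpleWalk i j = Σ (Walk M i j) (Unique ∘ vertices)

  suffix : ∀ {x i j} (w : Walk M i j) → Unique (vertices w) → x ∈ vertices w → SimpleWalk x j
  suffix ε       u             (here refl) = ε , u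
  suffix (e ◅ w) u             (here refl) = e ◅ w , u
  suffix (e ◅ w) (_ AllPairs.∷ u) (there x∈w) = suffix w u x∈w

  open DecMembership (_≟_ {n}) using (_∈?_)

  erase-loops : Walk M ⇒ SimpleWalk
  erase-loops ε = ε , (All.[] AllPairs.∷ AllPairs.[])
  erase-loops (_◅_ {i} e w) with erase-loops w
  ... | w′ , u with i ∈? vertices w′
  ...   | yes i∈w′ = suffix w′ u i∈w′
  ...   | no  i∉w′ = e ◅ w′ , ¬Any⇒All¬ (vertices w′) i∉w′ AllPairs.∷ u

lookup-injective : ∀ {a} {A : Set a} {xs : List A} → Unique xs → ∀ p q → lookup xs p ≡ lookup xs q → p ≡ q
lookup-injective (_ AllPairs.∷ _) zero    zero    _  = refl
lookup-injective (x∉ AllPairs.∷ _) zero    (suc q) eq = ⊥-elim (All.lookup x∉ (∈-lookup q) eq)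
lookup-injective (x∉ AllPairs.∷ _) (suc p) zero    eq = ⊥-elim (All.lookup x∉ (∈-lookup p) (sym eq))
lookup-injective (_ AllPairs.∷ u) (suc p) (suc q) eq = cong suc (lookup-injective u p q eq)

unique⇒length≤ : ∀ {n} {xs : List (Fin n)} → Unique xs → List.length xs ≤ n
unique⇒length≤ u = injective⇒≤ (lookup-injective u _ _)

module _ {n} {M : Mat n} where

  simple⇒length< : ∀ {i j} (w : Walk M i j) → Unique (vertices w) → length w < n
  simple⇒length< w u = subst (_≤ n) (length-vertices w) (unique⇒length≤ u)

  walk⇒* : Walk M ⇒ Entry (M *)
  walk⇒* w with erase-loops w
  ... | w′ , u = powSum-intro (<⇒≤ (simple⇒length< w′ u)) (pow-intro w′)

  *⇒walk : Entry (M *) ⇒ Walk M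
  *⇒walk = powSum-elim n

  *-refl : Reflexive (Entry (M *))
  *-refl = walk⇒* ε

  *-trans : Transitive (Entry (M *))
  *-trans s t = walk⇒* (*⇒walk s ◅◅ *⇒walk t)

  *-incl : Entry M ⇒ Entry (M *)
  *-incl e = walk⇒* (e ◅ ε)

*-mono : ∀ {n} {M N : Mat n} → Entry M ⇒ Entry N → Entry (M *) ⇒ Entry (N *)
*-mono M⇒N = walk⇒* ∘ map M⇒N ∘ *⇒walk

Lifts : ∀ {m n} → Mat n → (f g : Fin m → Fin n) → Mat m → Set
Lifts X f g M = ∀ {a b} → Entry M a b → Walk X (f a) (g b)

module _ {m n : ℕ} {X : Mat n} where

  lifts-⊗ : ∀ {f g h : Fin m → Fin n} {M N : Mat m} →
            Lifts X f g M → Lifts X g h N → Lifts X f h (M ⊗ N)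
  lifts-⊗ lifts-M lifts-N t with ⊗-elim t
  ... | _ , s , s′ = lifts-M s ◅◅ lifts-N s′

  lifts-⊕ : ∀ {f g : Fin m → Fin n} {M N : Mat m} →
            Lifts X f g M → Lifts X f g N → Lifts X f g (M ⊕ N)
  lifts-⊕ lifts-M lifts-N t with ⊕-elim t
  ... | inj₁ s = lifts-M s
  ... | inj₂ s = lifts-N s

  lifts-* : ∀ {f : Fin m → Fin n} {M : Mat m} → Lifts X f f M → Lifts X f f (M *)
  lifts-* {f} lifts-M = kleisliStar f lifts-M ∘ *⇒walk

module _ {m : ℕ} {ℓ : Level} where

  Quadrants : (E F G H : Rel (Fin m) ℓ) → Rel (Fin m ⊎ Fin m) ℓ
  Quadrants E F G H (inj₁ a) (inj₁ b) = E a b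
  Quadrants E F G H (inj₁ a) (inj₂ b) = F a b
  Quadrants E F G H (inj₂ a) (inj₁ b) = G a b
  Quadrants E F G H (inj₂ a) (inj₂ b) = H a b

  quadrants-elim : ∀ {ℓ′} {E F G H} {R : Rel (Fin m ⊎ Fin m) ℓ′} →
                   (∀ {a b} → E a b → R (inj₁ a) (inj₁ b)) →
                   (∀ {a b} → F a b → R (inj₁ a) (inj₂ b)) →
                   (∀ {a b} → G a b → R (inj₂ a) (inj₁ b)) →
                   (∀ {a b} → H a b → R (inj₂ a) (inj₂ b)) →
                   ∀ u v → Quadrants E F G H u v → R u v
  quadrants-elim e f g h (inj₁ _) (inj₁ _) = e
  quadrants-elim e f g h (inj₁ _) (inj₂ _) = f
  quadrants-elim e f g h (inj₂ _) (inj₁ _) = g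
  quadrants-elim e f g h (inj₂ _) (inj₂ _) = h

module _ (m : ℕ) where

  to-halves : ∀ {ℓ} (R : Rel (Fin (m + m)) ℓ) {i j} →
              R i j → R (join m m (splitAt m i)) (join m m (splitAt m j))
  to-halves R {i} {j} = subst₂ R (sym (join-splitAt m m i)) (sym (join-splitAt m m j))

  from-halves : ∀ {ℓ} (R : Rel (Fin (m + m)) ℓ) {i j} →
                R (join m m (splitAt m i)) (join m m (splitAt m j)) → R i j
  from-halves R {i} {j} = subst₂ R (join-splitAt m m i) (join-splitAt m m j)

  module _ {E F G H : Mat m} where

    blocks-elim : ∀ {i j} → Entry (blocks E F G H) i j →
                  Quadrants (Entry E) (Entry F) (Entry G) (Entry H) (splitAt m i) (splitAt m j)
    blocks-elim {i} {j} ⟨ t ⟩ with splitAt m i | splitAt m j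
    ... | inj₁ _ | inj₁ _ = ⟨ t ⟩
    ... | inj₁ _ | inj₂ _ = ⟨ t ⟩
    ... | inj₂ _ | inj₁ _ = ⟨ t ⟩
    ... | inj₂ _ | inj₂ _ = ⟨ t ⟩

    blocks-intro : ∀ {i j} → Quadrants (Entry E) (Entry F) (Entry G) (Entry H) (splitAt m i) (splitAt m j) →
                   Entry (blocks E F G H) i j
    blocks-intro {i} {j} q = ⟨ entry-of q ⟩
      where
      entry-of : Quadrants (Entry E) (Entry F) (Entry G) (Entry H) (splitAt m i) (splitAt m j) →
                 T (blocks E F G H i j)
      entry-of q with splitAt m i | splitAt m j
      ... | inj₁ _ | inj₁ _ = entry q
      ... | inj₁ _ | inj₂ _ = entry q
      ... | inj₂ _ | inj₁ _ = entry q
      ... | inj₂ _ | inj₂ _ = entry q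

module BlockClosure {m} (X : Mat (m + m)) where

  A B C D : Mat m
  A = blkA X
  B = blkB X
  C = blkC X
  D = blkD X

  P E₁ H₂ E₂ E F₁ F₂ F G₁ G₂ G H₁ H : Mat m
  P  = D *
  E₁ = (A ⊕ B ⊗ (P ⊗ P) ⊗ C) *
  H₂ = (D ⊕ C ⊗ (E₁ ⊗ E₁) ⊗ B) *
  E₂ = E₁ ⊗ B ⊗ (H₂ ⊗ H₂) ⊗ C ⊗ E₁
  E  = E₁ ⊕ E₂
  F₁ = (E₁ ⊗ E₁) ⊗ B ⊗ P
  F₂ = E₁ ⊗ B ⊗ (H₂ ⊗ H₂)
  F  = F₁ ⊕ F₂
  G₁ = P ⊗ C ⊗ (E₁ ⊗ E₁)
  G₂ = (H₂ ⊗ H₂) ⊗ C ⊗ E₁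
  G  = G₁ ⊕ G₂
  H₁ = P ⊗ C ⊗ (E₁ ⊗ E₁) ⊗ B ⊗ P
  H  = H₁ ⊕ H₂

  top bottom : Fin m → Fin (m + m)
  top    = join m m ∘ inj₁
  bottom = join m m ∘ inj₂

  lifts-A : Lifts X top top A
  lifts-A ⟨ x ⟩ = ⟨ x ⟩ ◅ ε

  lifts-B : Lifts X top bottom B
  lifts-B ⟨ x ⟩ = ⟨ x ⟩ ◅ ε

  lifts-C : Lifts X bottom top C
  lifts-C ⟨ x ⟩ = ⟨ x ⟩ ◅ ε

  lifts-D : Lifts X bottom bottom D
  lifts-D ⟨ x ⟩ = ⟨ x ⟩ ◅ ε

  lifts-P : Lifts X bottom bottom P
  lifts-P = lifts-* lifts-D

  lifts-E₁ : Lifts X top top E₁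
  lifts-E₁ = lifts-* (lifts-⊕ lifts-A (lifts-⊗ (lifts-⊗ lifts-B (lifts-⊗ lifts-P lifts-P)) lifts-C))

  lifts-H₂ : Lifts X bottom bottom H₂
  lifts-H₂ = lifts-* (lifts-⊕ lifts-D (lifts-⊗ (lifts-⊗ lifts-C (lifts-⊗ lifts-E₁ lifts-E₁)) lifts-B))

  lifts-E : Lifts X top top E
  lifts-E = lifts-⊕ lifts-E₁
    (lifts-⊗ (lifts-⊗ (lifts-⊗ (lifts-⊗ lifts-E₁ lifts-B) (lifts-⊗ lifts-H₂ lifts-H₂)) lifts-C) lifts-E₁)

  lifts-F : Lifts X top bottom F
  lifts-F = lifts-⊕ (lifts-⊗ (lifts-⊗ (lifts-⊗ lifts-E₁ lifts-E₁) lifts-B) lifts-P)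
    (lifts-⊗ (lifts-⊗ lifts-E₁ lifts-B) (lifts-⊗ lifts-H₂ lifts-H₂))

  lifts-G : Lifts X bottom top G
  lifts-G = lifts-⊕ (lifts-⊗ (lifts-⊗ lifts-P lifts-C) (lifts-⊗ lifts-E₁ lifts-E₁))
    (lifts-⊗ (lifts-⊗ (lifts-⊗ lifts-H₂ lifts-H₂) lifts-C) lifts-E₁)

  lifts-H : Lifts X bottom bottom H
  lifts-H = lifts-⊕ (lifts-⊗ (lifts-⊗ (lifts-⊗ (lifts-⊗ lifts-P lifts-C) (lifts-⊗ lifts-E₁ lifts-E₁)) lifts-B) lifts-P)
    lifts-H₂

  ℋ-sound : Entry (ℋ {m} X) ⇒ Walk X
  ℋ-sound {i} {j} t = from-halves m (Walk X)
    (quadrants-elim {R = λ u v → Walk X (join m m u) (join m m v)} lifts-E lifts-F lifts-G lifts-H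
      (splitAt m i) (splitAt m j) (blocks-elim m t))

  A⇒E₁ : Entry A ⇒ Entry E₁
  A⇒E₁ a = *-incl (⊕-intro (inj₁ a))

  BPC⇒E₁ : ∀ {a b c d} → Entry B a b → Entry P b c → Entry C c d → Entry E₁ a d
  BPC⇒E₁ b p c = *-incl (⊕-intro (inj₂ (⊗-intro (⊗-intro b (⊗-intro p *-refl)) c)))

  DP⇒P : ∀ {a b c} → Entry D a b → Entry P b c → Entry P a c
  DP⇒P d p = *-trans (*-incl d) p

  Closure : Rel (Fin m ⊎ Fin m) 0ℓ
  Closure = Quadrants (Entry E₁) (Entry E₁ ; Entry B ; Entry P) (Entry P ; Entry C ; Entry E₁)
                      (Entry P ∪ Entry P ; Entry C ; Entry E₁ ; Entry B ; Entry P)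

  closure-refl : ∀ u → Closure u u
  closure-refl (inj₁ _) = *-refl
  closure-refl (inj₂ _) = inj₁ *-refl

  closure-step : ∀ u w v → Entry X (join m m u) (join m m w) → Closure w v → Closure u v
  closure-step (inj₁ _) (inj₁ _) (inj₁ _) ⟨ x ⟩ e                 = *-trans (A⇒E₁ ⟨ x ⟩) e
  closure-step (inj₁ _) (inj₁ _) (inj₂ _) ⟨ x ⟩ (_ , e , r)       = _ , *-trans (A⇒E₁ ⟨ x ⟩) e , r
  closure-step (inj₁ _) (inj₂ _) (inj₁ _) ⟨ x ⟩ (_ , p , _ , c , e) = *-trans (BPC⇒E₁ ⟨ x ⟩ p c) e
  closure-step (inj₁ _) (inj₂ _) (inj₂ _) ⟨ x ⟩ (inj₁ p)          = _ , *-refl , _ , ⟨ x ⟩ , p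
  closure-step (inj₁ _) (inj₂ _) (inj₂ _) ⟨ x ⟩ (inj₂ (_ , p , _ , c , _ , e , r)) =
    _ , *-trans (BPC⇒E₁ ⟨ x ⟩ p c) e , r
  closure-step (inj₂ _) (inj₁ _) (inj₁ _) ⟨ x ⟩ e                 = _ , *-refl , _ , ⟨ x ⟩ , e
  closure-step (inj₂ _) (inj₁ _) (inj₂ _) ⟨ x ⟩ (_ , e , r)       = inj₂ (_ , *-refl , _ , ⟨ x ⟩ , _ , e , r)
  closure-step (inj₂ _) (inj₂ _) (inj₁ _) ⟨ x ⟩ (_ , p , r)       = _ , DP⇒P ⟨ x ⟩ p , r
  closure-step (inj₂ _) (inj₂ _) (inj₂ _) ⟨ x ⟩ (inj₁ p)          = inj₁ (DP⇒P ⟨ x ⟩ p)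
  closure-step (inj₂ _) (inj₂ _) (inj₂ _) ⟨ x ⟩ (inj₂ (_ , p , r)) = inj₂ (_ , DP⇒P ⟨ x ⟩ p , r)

  walk⇒closure : ∀ {i j} → Walk X i j → Closure (splitAt m i) (splitAt m j)
  walk⇒closure = fold (λ i j → Closure (splitAt m i) (splitAt m j))
    (λ {i} {k} {j} x → closure-step (splitAt m i) (splitAt m k) (splitAt m j) (to-halves m (Entry X) x))
    (λ {i} → closure-refl (splitAt m i))

  closure⇒ℋ : ∀ u v → Closure u v → Quadrants (Entry E) (Entry F) (Entry G) (Entry H) u v
  closure⇒ℋ = quadrants-elim {R = Quadrants (Entry E) (Entry F) (Entry G) (Entry H)}
    (λ e → ⊕-intro (inj₁ e))
    (λ (_ , e , _ , b , p) → ⊕-intro (inj₁ (⊗-intro (⊗-intro (⊗-intro e *-refl) b) p)))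
    (λ (_ , p , _ , c , e) → ⊕-intro (inj₁ (⊗-intro (⊗-intro p c) (⊗-intro e *-refl))))
    (λ { (inj₁ p) → ⊕-intro (inj₂ (*-mono (λ d → ⊕-intro (inj₁ d)) p))
       ; (inj₂ (_ , p , _ , c , _ , e , _ , b , p′)) →
           ⊕-intro (inj₁ (⊗-intro (⊗-intro (⊗-intro (⊗-intro p c) (⊗-intro e *-refl)) b) p′)) })

  ℋ-complete : Walk X ⇒ Entry (ℋ {m} X)
  ℋ-complete {i} {j} w = blocks-intro m (closure⇒ℋ (splitAt m i) (splitAt m j) (walk⇒closure w))

lemma5 : (k : ℕ) (m : ℕ) → m ≡ 2 ^ k → (X : Mat (m + m)) →
    ∀ (i j : Fin (m + m)) → ℋ {m} X i j ≡ (X *) i j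
lemma5 _ m _ X = entrywise-≡ (walk⇒* ∘ ℋ-sound) (ℋ-complete ∘ *⇒walk)
  where open BlockClosure {m} X
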